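{- Let $n$ be a positive integer and let $G_n$ be a $2$-connected outerplanar graph with $n$ vertices and diameter $2$. Then \[ \Delta(G_n)\le \chi'_{st}(G_n)\le \begin{cases} n+1, & n=5,\\ n, & n=4,6,7,\\ \Delta(G_n), & n\ge 8. \end{cases} \]
   Context: All graphs are finite, simple and undirected. $\Delta(G)$ denotes the maximum degree of $G$. An outerplanar graph is a graph that can be drawn in the plane without edge crossings so that all vertices lie on the boundary of the same (outer) face. The diameter of a connected graph is the maximum distance between two of its vertices. A star edge coloring of $G$ is a proper edge coloring of $G$ in which there is no path or cycle of length four (i.e., with four edges) whose edges use only two colors. The star chromatic index $\chi'_{st}(G)$ is the minimum number of colors in a star edge coloring of $G$. -}

module Defs where

open import Data.Nat using (ℕ; zero; suc; _+_; _≤_; _<_; _⊔_)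
open import Data.Fin using (Fin; toℕ)
open import Data.Bool using (Bool; true; false)
open import Data.List using (List; length; filter; foldr; map; allFin)
open import Data.Product using (Σ; _×_; ∃; ∃-syntax; _,_)
open import Data.Sum using (_⊎_)
open import Relation.Binary.PropositionalEquality using (_≡_; _≢_)
open import Relation.Nullary using (¬_)
open import Function.Definitions using (Injective)
import Data.Unit
import Data.Bool

record Graph (n : ℕ) : Set where
  field
    adj   : Fin n → Fin n → Bool
    sym   : ∀ u v → adj u v ≡ adj v u
    irrfl : ∀ u → adj u u ≡ false

module _ {n : ℕ} (G : Graph n) where
  open Graph G

  Adj : Fin n → Fin n → Set
  Adj u v = adj u v ≡ true

  deg : Fin n → ℕ
  deg u = length (filter (λ v → Data.Bool._≟_ (adj u v) true) (allFin n))

  maxDeg : ℕ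
  maxDeg = foldr _⊔_ 0 (map deg (allFin n))

  data WalkIn (P : Fin n → Set) : Fin n → Fin n → Set where
    here : ∀ {u} → P u → WalkIn P u u
    step : ∀ {u w v} → P u → Adj u w → WalkIn P w v → WalkIn P u v

  Connected : Set
  Connected = ∀ u v → WalkIn (λ _ → Data.Unit.⊤) u v

  ConnectedWithout : Fin n → Set
  ConnectedWithout x = ∀ u v → u ≢ x → v ≢ x → WalkIn (λ w → w ≢ x) u v

  TwoConnected : Set
  TwoConnected = (3 ≤ n) × Connected × (∀ x → ConnectedWithout x)

  DistLe1 : Fin n → Fin n → Set
  DistLe1 u v = (u ≡ v) ⊎ Adj u v

  DistLe2 : Fin n → Fin n → Set
  DistLe2 u v = DistLe1 u v ⊎ (∃[ w ] (Adj u w × Adj w v))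

  Diameter2 : Set
  Diameter2 = Connected × (∀ u v → DistLe2 u v) × (∃[ u ] ∃[ v ] (¬ DistLe1 u v))

  -- outerplanar: the vertices can be placed on a circle (cyclic order given by the
  -- injective position map σ) so that the edges, drawn as chords, do not cross.
  Outerplanar : Set
  Outerplanar = Σ (Fin n → Fin n) λ σ → Injective _≡_ _≡_ σ ×
    (∀ a b c d → Adj a b → Adj c d →
       ¬ (toℕ (σ a) < toℕ (σ c) × toℕ (σ c) < toℕ (σ b) × toℕ (σ b) < toℕ (σ d)))

  record EdgeColoring (k : ℕ) : Set where
    field
      col    : Fin n → Fin n → Fin k
      colSym : ∀ u v → Adj u v → col u v ≡ col v u

  module _ {k : ℕ} (c : EdgeColoring k) where
    open EdgeColoring c

    Proper : Set
    Proper = ∀ u v w → Adj u v → Adj u w → v ≢ w → col u v ≢ col u w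

    -- the walk v0 v1 v2 v3 v4 (a path of length 4 if v4 ∉ {v0..v3},
    -- a 4-cycle if v4 ≡ v0) uses only two colours
    TwoColoredP4orC4 : Set
    TwoColoredP4orC4 = ∃[ v0 ] ∃[ v1 ] ∃[ v2 ] ∃[ v3 ] ∃[ v4 ]
      ( (v0 ≢ v1 × v0 ≢ v2 × v0 ≢ v3 × v1 ≢ v2 × v1 ≢ v3 × v2 ≢ v3
         × v4 ≢ v1 × v4 ≢ v2 × v4 ≢ v3)
      × Adj v0 v1 × Adj v1 v2 × Adj v2 v3 × Adj v3 v4
      × (∃[ a ] ∃[ b ] ( (col v0 v1 ≡ a ⊎ col v0 v1 ≡ b)
                       × (col v1 v2 ≡ a ⊎ col v1 v2 ≡ b)
                       × (col v2 v3 ≡ a ⊎ col v2 v3 ≡ b)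
                       × (col v3 v4 ≡ a ⊎ col v3 v4 ≡ b))))

    StarEdgeColoring : Set
    StarEdgeColoring = Proper × ¬ TwoColoredP4orC4

  StarColorable : ℕ → Set
  StarColorable k = Σ (EdgeColoring k) StarEdgeColoring

  IsStarChromaticIndex : ℕ → Set
  IsStarChromaticIndex k = StarColorable k × (∀ j → StarColorable j → k ≤ j)

{-# OPTIONS --safe #-}
module Submission where

-- Draw G with its vertices at the positions 0 … n - 1 of a circle, so that edges are
-- non-crossing chords.  If a chord ab leaves at least two positions on each side, every path
-- of length two between the sides passes through a or b, and this forces a or b to be adjacent
-- to all other vertices.  Otherwise every chord joins positions at cyclic distance two, and for
-- n ≥ 7 the diameter condition then produces two crossing chords; so G has a universal vertex
-- and, being outerplanar, lies inside the fan with that hub.  The fan on n vertices has a star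
-- edge colouring with max (n - 1) 7 colours, giving Δ colours for n ≥ 8.  For n ≤ 6 the same
-- analysis puts G inside a fan, the 3-sun, K₄ minus a diagonal or a triangle, whose colourings
-- are checked by evaluation.  The star chromatic index exists since star colourability is
-- decidable, and it is at least Δ because a star colouring is proper.

open import Defs
open import Data.Nat
  using (ℕ; zero; suc; _+_; _*_; _∸_; _≤_; _<_; _⊔_; _⊓_; z≤n; s≤s; z<s; s≤s⁻¹; ∣_-_∣; NonZero)
open import Data.Nat.Properties
open import Data.Nat.Induction using (<-rec)
open import Data.Nat.DivMod using (_%_; _/_; _mod_; m%n<n; m<n⇒m%n≡m; n%n≡0; m%n%n≡m%n; %-distribˡ-+; m≡m%n+[m/n]*n)
open import Data.Fin as Fin using (Fin; toℕ; #_; punchIn; combine; remQuot)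
open import Data.Fin.Properties as Finₚ
  using (any?; all?; injective⇒≤; punchIn-injective; punchInᵢ≢i; punchOut-injective; remQuot-combine;
         toℕ-injective; toℕ<n; toℕ-fromℕ<)
open import Data.Vec as Vec using (Vec; []; _∷_)
open import Data.Vec.Properties using (lookup∘tabulate)
open import Data.Bool using (Bool; true; T)
open import Data.Bool.Properties using (T?)
open import Data.Maybe using (Maybe; just; nothing; is-just; fromMaybe)
open import Data.List using (List; []; _∷_; filter; foldr; map; allFin; lookup; upTo; cartesianProduct)
open import Data.List.Membership.Propositional using (_∈_; lose)
open import Data.List.Membership.Propositional.Properties
  using (∈-lookup; ∈-allFin; ∈-filter⁺; ∈-filter⁻; ∈-upTo⁺; ∈-cartesianProduct⁺)
open import Data.List.Relation.Unary.Any as Any using (Any; here; there)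
open import Data.List.Relation.Unary.Any.Properties using (lookup-index)
open import Data.List.Relation.Unary.All as All using (All; []; _∷_)
open import Data.List.Relation.Unary.Unique.Propositional using (Unique; _∷_)
import Data.List.Relation.Unary.Unique.Propositional.Properties as Uniqueₚ
open import Data.Product using (Σ; ∃; ∃-syntax; _×_; _,_; proj₁; proj₂; uncurry)
open import Data.Sum as Sum using (_⊎_; inj₁; inj₂; [_,_]′)
open import Data.Empty using (⊥; ⊥-elim)
open import Function using (_∘_; id)
open import Function.Definitions using (Injective)
open import Relation.Binary.Definitions using (Tri; tri<; tri≈; tri>)
open import Relation.Binary.PropositionalEquality
open import Relation.Nullary using (¬_; Dec; yes; no; contradiction)
open import Relation.Nullary.Decidable as Dec
  using (_×-dec_; _⊎-dec_; _→-dec_; ¬?; isYes; True; False; toWitness; toWitnessFalse)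
open import Relation.Unary using (Decidable)

lt : ∀ {m n} {m<n : True (m <? n)} → m < n
lt {m<n = m<n} = toWitness m<n

Least : (ℕ → Set) → ℕ → Set
Least P k = P k × (∀ j → P j → k ≤ j)

least : ∀ {P : ℕ → Set} → Decidable P → ∀ {K} → P K → ∃ (Least P)
least {P} P? = <-rec (λ K → P K → ∃ (Least P)) search _
  where
  search : ∀ K → (∀ {j} → j < K → P j → ∃ (Least P)) → P K → ∃ (Least P)
  search K below pK with anyUpTo? P? K
  ... | yes (j , j<K , pj) = below j<K pj
  ... | no none = K , pK , λ j pj → ≮⇒≥ λ j<K → none (j , j<K , pj)

anyVec? : ∀ {A : Set} → (∀ {P : A → Set} → Decidable P → Dec (∃ P)) →
          ∀ m {P : Vec A m → Set} → Decidable P → Dec (∃ P)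
anyVec? search zero P? = Dec.map′ ([] ,_) (λ { ([] , p) → p }) (P? [])
anyVec? search (suc m) P? =
  Dec.map′ (λ (a , v , p) → a ∷ v , p) (λ { (a ∷ v , p) → a , v , p })
           (search λ a → anyVec? search m (λ v → P? (a ∷ v)))

lookup-injective : ∀ {A : Set} {xs : List A} → Unique xs → ∀ {i j} → lookup xs i ≡ lookup xs j → i ≡ j
lookup-injective (x∉xs ∷ u) {Fin.zero} {Fin.zero} eq = refl
lookup-injective (x∉xs ∷ u) {Fin.zero} {Fin.suc j} eq = contradiction eq (All.lookup x∉xs (∈-lookup j))
lookup-injective (x∉xs ∷ u) {Fin.suc i} {Fin.zero} eq = contradiction (sym eq) (All.lookup x∉xs (∈-lookup i))
lookup-injective (x∉xs ∷ u) {Fin.suc i} {Fin.suc j} eq = cong Fin.suc (lookup-injective u eq)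

injective⇒surjective : ∀ {n} {f : Fin n → Fin n} → Injective _≡_ _≡_ f → ∀ y → ∃[ x ] f x ≡ y
injective⇒surjective {suc m} {f} f-injective y with any? (λ x → f x Finₚ.≟ y)
... | yes hit = hit
... | no miss = contradiction (injective⇒≤ {f = avoid} avoid-injective) 1+n≰n
  where
  avoid : Fin (suc m) → Fin m
  avoid x = Fin.punchOut {i = y} {j = f x} λ y≡fx → miss (x , sym y≡fx)
  avoid-injective : Injective _≡_ _≡_ avoid
  avoid-injective eq = f-injective (punchOut-injective {i = y} _ _ eq)

module _ {n : ℕ} (G : Graph n) where
  open Graph G using (adj)
  open EdgeColoring

  adj? : ∀ u v → Dec (Adj G u v)
  adj? u v = adj u v Data.Bool.≟ true

  neighbours : Fin n → List (Fin n)
  neighbours u = filter (adj? u) (allFin n)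

  IsUniversal : Fin n → Set
  IsUniversal w = ∀ v → v ≢ w → Adj G w v

  deg≤colours : ∀ {k} (c : EdgeColoring G k) → Proper G c → ∀ u → deg G u ≤ k
  deg≤colours c proper u = injective⇒≤ {f = col c u ∘ lookup (neighbours u)} λ {i} {j} eq →
    lookup-injective (Uniqueₚ.filter⁺ (adj? u) (Uniqueₚ.allFin⁺ n))
      (colour-injective (∈-lookup i) (∈-lookup j) eq)
    where
    colour-injective : ∀ {v w} → v ∈ neighbours u → w ∈ neighbours u → col c u v ≡ col c u w → v ≡ w
    colour-injective {v} {w} v∈ w∈ eq with v Finₚ.≟ w
    ... | yes v≡w = v≡w
    ... | no v≢w = contradiction eq (proper u v w (adjacent v∈) (adjacent w∈) v≢w)
      where
      adjacent : ∀ {x} → x ∈ neighbours u → Adj G u x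
      adjacent x∈ = proj₂ (∈-filter⁻ (adj? u) {xs = allFin n} x∈)

  maxDeg≤ : ∀ {k} → (∀ u → deg G u ≤ k) → maxDeg G ≤ k
  maxDeg≤ {k} bound = go (allFin n)
    where
    go : ∀ us → foldr _⊔_ 0 (map (deg G) us) ≤ k
    go [] = z≤n
    go (u ∷ us) = ⊔-lub (bound u) (go us)

  deg≤maxDeg : ∀ u → deg G u ≤ maxDeg G
  deg≤maxDeg u = go (allFin n) (∈-allFin u)
    where
    go : ∀ us → u ∈ us → deg G u ≤ foldr _⊔_ 0 (map (deg G) us)
    go (v ∷ us) (here refl) = m≤m⊔n _ _
    go (v ∷ us) (there u∈us) = ≤-trans (go us u∈us) (m≤n⊔m _ _)

  universal-deg : ∀ {m w} → IsUniversal w → n ≡ suc m → m ≤ deg G w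
  universal-deg {w = w} universal refl = injective⇒≤ {f = position} λ {i} {j} eq →
    punchIn-injective w i j (begin
      punchIn w i                          ≡⟨ lookup-index (member i) ⟩
      lookup (neighbours w) (position i)   ≡⟨ cong (lookup (neighbours w)) eq ⟩
      lookup (neighbours w) (position j)   ≡⟨ lookup-index (member j) ⟨
      punchIn w j                          ∎)
    where
    open ≡-Reasoning
    member : ∀ i → punchIn w i ∈ neighbours w
    member i = ∈-filter⁺ (adj? w) (∈-allFin _) (universal _ (punchInᵢ≢i w i))
    position : ∀ i → Fin (deg G w)
    position i = Any.index (member i)

  module _ {k : ℕ} where

    proper? : (c : EdgeColoring G k) → Dec (Proper G c)
    proper? c = all? λ u → all? λ v → all? λ w →
      adj? u v →-dec adj? u w →-dec ¬? (v Finₚ.≟ w) →-dec ¬? (col c u v Finₚ.≟ col c u w)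

    twoColoured? : (c : EdgeColoring G k) → Dec (TwoColoredP4orC4 G c)
    twoColoured? c =
      any? λ v₀ → any? λ v₁ → any? λ v₂ → any? λ v₃ → any? λ v₄ →
        (v₀ ≢? v₁ ×-dec v₀ ≢? v₂ ×-dec v₀ ≢? v₃ ×-dec v₁ ≢? v₂ ×-dec v₁ ≢? v₃ ×-dec v₂ ≢? v₃
          ×-dec v₄ ≢? v₁ ×-dec v₄ ≢? v₂ ×-dec v₄ ≢? v₃)
        ×-dec adj? v₀ v₁ ×-dec adj? v₁ v₂ ×-dec adj? v₂ v₃ ×-dec adj? v₃ v₄
        ×-dec any? λ a → any? λ b →
          oneOf (col c v₀ v₁) a b ×-dec oneOf (col c v₁ v₂) a b
            ×-dec oneOf (col c v₂ v₃) a b ×-dec oneOf (col c v₃ v₄) a b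
      where
      _≢?_ : ∀ (x y : Fin n) → Dec (x ≢ y)
      x ≢? y = ¬? (x Finₚ.≟ y)
      oneOf : ∀ (x a b : Fin k) → Dec (x ≡ a ⊎ x ≡ b)
      oneOf x a b = (x Finₚ.≟ a) ⊎-dec (x Finₚ.≟ b)

    star-cong : (c d : EdgeColoring G k) → (∀ u v → col c u v ≡ col d u v) →
                StarEdgeColoring G c → StarEdgeColoring G d
    star-cong c d c≗d (proper , noTwo) = proper′ , noTwo ∘ twoColoured′
      where
      proper′ : Proper G d
      proper′ u v w uv uw v≢w eq = proper u v w uv uw v≢w (trans (c≗d u v) (trans eq (sym (c≗d u w))))
      back : ∀ {x y a b} → col d x y ≡ a ⊎ col d x y ≡ b → col c x y ≡ a ⊎ col c x y ≡ b
      back {x} {y} {a} {b} = subst (λ z → z ≡ a ⊎ z ≡ b) (sym (c≗d x y))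
      twoColoured′ : TwoColoredP4orC4 G d → TwoColoredP4orC4 G c
      twoColoured′ (v₀ , v₁ , v₂ , v₃ , v₄ , ds , e₁ , e₂ , e₃ , e₄ , a , b , c₁ , c₂ , c₃ , c₄) =
        v₀ , v₁ , v₂ , v₃ , v₄ , ds , e₁ , e₂ , e₃ , e₄ , a , b , back c₁ , back c₂ , back c₃ , back c₄

    ColourVector : Set
    ColourVector = Vec (Fin k) (n * n)

    fromVector : ColourVector → Fin n → Fin n → Fin k
    fromVector t u v = Vec.lookup t (combine u v)

    toVector : EdgeColoring G k → ColourVector
    toVector c = Vec.tabulate λ i → uncurry (col c) (remQuot n i)

    fromVector-toVector : ∀ c u v → fromVector (toVector c) u v ≡ col c u v
    fromVector-toVector c u v =
      trans (lookup∘tabulate _ (combine u v)) (cong (uncurry (col c)) (remQuot-combine u v))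

    StarVector : ColourVector → Set
    StarVector t = Σ (∀ u v → Adj G u v → fromVector t u v ≡ fromVector t v u) λ s →
                  StarEdgeColoring G record { col = fromVector t ; colSym = s }

    starVector? : Decidable StarVector
    starVector? t with all? (λ u → all? λ v → adj? u v →-dec (fromVector t u v Finₚ.≟ fromVector t v u))
    ... | no ¬s = no (¬s ∘ proj₁)
    ... | yes s = Dec.map′ (s ,_) proj₂ (proper? c′ ×-dec ¬? (twoColoured? c′))
      where c′ = record { col = fromVector t ; colSym = s }

  starColorable? : ∀ k → Dec (StarColorable G k)
  starColorable? k = Dec.map′ fromStarVector toStarVector (anyVec? any? (n * n) starVector?)
    where
    fromStarVector : ∃ StarVector → StarColorable G k
    fromStarVector (t , s , star) = record { col = fromVector t ; colSym = s } , star
    toStarVector : StarColorable G k → ∃ StarVector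
    toStarVector (c , star) = toVector c , symmetric ,
                             star-cong c record { col = fromVector (toVector c) ; colSym = symmetric }
                               (λ u v → sym (fromVector-toVector c u v)) star
      where
      symmetric : ∀ u v → Adj G u v → fromVector (toVector c) u v ≡ fromVector (toVector c) v u
      symmetric u v uv = trans (fromVector-toVector c u v) (trans (colSym c u v uv) (sym (fromVector-toVector c v u)))

module _ {n : ℕ} (G : Graph n) where

  record Drawing : Set where
    field
      pos           : Fin n → ℕ
      pos<          : ∀ u → pos u < n
      pos-injective : ∀ {u v} → pos u ≡ pos v → u ≡ v
      pos-onto      : ∀ {x} → x < n → ∃[ u ] pos u ≡ x
      nonCrossing   : ∀ {a b c d} → Adj G a b → Adj G c d →
                      pos a < pos c → pos c < pos b → pos b < pos d → ⊥

  outerplanar⇒drawing : Outerplanar G → Drawing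
  outerplanar⇒drawing (σ , σ-injective , nonCrossing) = record
    { pos           = toℕ ∘ σ
    ; pos<          = toℕ<n ∘ σ
    ; pos-injective = σ-injective ∘ toℕ-injective
    ; pos-onto      = λ x<n → let (u , σu≡x) = injective⇒surjective σ-injective (Fin.fromℕ< x<n)
                              in u , trans (cong toℕ σu≡x) (toℕ-fromℕ< x<n)
    ; nonCrossing   = λ ab cd a<c c<b b<d → nonCrossing _ _ _ _ ab cd (a<c , c<b , b<d)
    }

module _ {n : ℕ} .{{_ : NonZero n}} where

  next : ℕ → ℕ
  next x = suc x % n

  next-view : ∀ {x} → x < n → (suc x < n × next x ≡ suc x) ⊎ (suc x ≡ n × next x ≡ 0)
  next-view {x} x<n with m≤n⇒m<n∨m≡n x<n
  ... | inj₁ 1+x<n = inj₁ (1+x<n , m<n⇒m%n≡m 1+x<n)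
  ... | inj₂ 1+x≡n = inj₂ (1+x≡n , trans (cong (_% n) 1+x≡n) (n%n≡0 n))

  next-unwrapped : ∀ {x y} → x < n → y < next x → suc x < n × next x ≡ suc x
  next-unwrapped {y = y} x<n y<next with next-view x<n
  ... | inj₁ unwrapped = unwrapped
  ... | inj₂ (_ , eq) = contradiction (subst (y <_) eq y<next) λ ()

  next-% : ∀ x → next (x % n) ≡ suc x % n
  next-% x = begin
    (1 + x % n) % n            ≡⟨ %-distribˡ-+ 1 (x % n) n ⟩
    (1 % n + x % n % n) % n    ≡⟨ cong (λ y → (1 % n + y) % n) (m%n%n≡m%n x n) ⟩
    (1 % n + x % n) % n        ≡⟨ %-distribˡ-+ 1 x n ⟨
    (1 + x) % n                ∎
    where open ≡-Reasoning

module _ {n : ℕ} {G : Graph n} .{{_ : NonZero n}} where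

  rotate : Drawing G → Drawing G
  rotate D = record
    { pos           = next ∘ pos
    ; pos<          = λ u → m%n<n (suc (pos u)) n
    ; pos-injective = λ eq → pos-injective (next-injective (pos< _) (pos< _) eq)
    ; pos-onto      = onto
    ; nonCrossing   = crossing
    }
    where
    open Drawing D
    next-injective : ∀ {x y} → x < n → y < n → next x ≡ next y → x ≡ y
    next-injective x<n y<n eq with next-view x<n | next-view y<n
    ... | inj₁ (_ , ex) | inj₁ (_ , ey) = suc-injective (trans (sym ex) (trans eq ey))
    ... | inj₂ (ex , _) | inj₂ (ey , _) = suc-injective (trans ex (sym ey))
    ... | inj₁ (_ , ex) | inj₂ (_ , ey) = contradiction (trans (sym ex) (trans eq ey)) λ ()
    ... | inj₂ (_ , ex) | inj₁ (_ , ey) = contradiction (trans (sym ey) (trans (sym eq) ex)) λ ()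
    n∸1<n : 0 < n → n ∸ 1 < n
    n∸1<n 0<n = ∸-monoʳ-< {o = 0} (s≤s z≤n) 0<n
    onto : ∀ {x} → x < n → ∃[ u ] next (pos u) ≡ x
    onto {zero} 0<n with pos-onto (n∸1<n 0<n)
    ... | u , eq = u , trans (cong next eq) (trans (cong (_% n) (m+[n∸m]≡n 0<n)) (n%n≡0 n))
    onto {suc x} 1+x<n with pos-onto (<-trans (n<1+n x) 1+x<n)
    ... | u , refl = u , m<n⇒m%n≡m 1+x<n
    -- only the smallest of the four new positions can have wrapped round to 0, and if it has,
    -- the old positions are in the crossing order c < b < d < a
    crossing : ∀ {a b c d} → Adj G a b → Adj G c d →
               next (pos a) < next (pos c) → next (pos c) < next (pos b) → next (pos b) < next (pos d) → ⊥
    crossing {a} {b} {c} {d} ab cd a<c c<b b<d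
      with next-unwrapped (pos< c) a<c | next-unwrapped (pos< b) c<b | next-unwrapped (pos< d) b<d
    ... | _ , c′ | _ , b′ | 1+d<n , d′ with next-view (pos< a)
    ... | inj₁ (_ , a′) rewrite a′ | b′ | c′ | d′ = nonCrossing ab cd (s≤s⁻¹ a<c) (s≤s⁻¹ c<b) (s≤s⁻¹ b<d)
    ... | inj₂ (1+a≡n , _) rewrite b′ | c′ | d′ =
      nonCrossing cd (trans (Graph.sym G b a) ab) (s≤s⁻¹ c<b) (s≤s⁻¹ b<d)
                  (s≤s⁻¹ (subst (suc (pos d) <_) (sym 1+a≡n) 1+d<n))

  rotateBy : ℕ → Drawing G → Drawing G
  rotateBy zero    D = D
  rotateBy (suc k) D = rotate (rotateBy k D)

  pos-rotateBy : ∀ k D u → Drawing.pos (rotateBy k D) u ≡ (Drawing.pos D u + k) % n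
  pos-rotateBy zero D u =
    sym (trans (cong (_% n) (+-identityʳ _)) (m<n⇒m%n≡m (Drawing.pos< D u)))
  pos-rotateBy (suc k) D u =
    trans (cong next (pos-rotateBy k D u)) (trans (next-% _) (cong (_% n) (sym (+-suc _ k))))

  centre : Drawing G → Fin n → Drawing G
  centre D w = rotateBy (n ∸ Drawing.pos D w) D

  pos-centre : ∀ D w → Drawing.pos (centre D w) w ≡ 0
  pos-centre D w = begin
    Drawing.pos (centre D w) w        ≡⟨ pos-rotateBy (n ∸ p) D w ⟩
    (p + (n ∸ p)) % n                 ≡⟨ cong (_% n) (m+[n∸m]≡n (<⇒≤ (Drawing.pos< D w))) ⟩
    n % n                             ≡⟨ n%n≡0 n ⟩
    0                                 ∎
    where
    open ≡-Reasoning
    p = Drawing.pos D w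

-- a graph on the positions, consulted only on pairs x < y
Template : Set
Template = ℕ → ℕ → Bool

link : Template → ℕ → ℕ → Bool
link t x y = t (x ⊓ y) (x ⊔ y)

link-ordered : ∀ t {x y} → x ≤ y → link t x y ≡ t x y
link-ordered t x≤y = cong₂ t (m≤n⇒m⊓n≡m x≤y) (m≤n⇒m⊔n≡n x≤y)

link-sym : ∀ t x y → link t x y ≡ link t y x
link-sym t x y = cong₂ t (⊓-comm x y) (⊔-comm x y)

link-cases : ∀ {t x y} → x ≢ y → T (link t x y) → (x < y × T (t x y)) ⊎ (y < x × T (t y x))
link-cases {t} {x} {y} x≢y txy with <-cmp x y
... | tri< x<y _ _ = inj₁ (x<y , subst T (link-ordered t (<⇒≤ x<y)) txy)
... | tri≈ _ x≡y _ = contradiction x≡y x≢y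
... | tri> _ _ y<x = inj₂ (y<x , subst T (trans (link-sym t x y) (link-ordered t (<⇒≤ y<x))) txy)

fan : Template
fan x y = isYes ((x ≟ 0) ⊎-dec (suc x ≟ y))

omitted : ℕ → Template → List (ℕ × ℕ)
omitted n t = filter (λ (x , y) → x <? y ×-dec ¬? (T? (t x y))) (cartesianProduct (upTo n) (upTo n))

-- t turned k positions backwards
rotated : (n k : ℕ) .{{_ : NonZero n}} → Template → Template
rotated n k t x y = link t ((x + k) % n) ((y + k) % n)

link-rotated : ∀ n k .{{_ : NonZero n}} t x y → link (rotated n k t) x y ≡ link t ((x + k) % n) ((y + k) % n)
link-rotated n k t x y with ≤-total x y
... | inj₁ x≤y = link-ordered (rotated n k t) x≤y
... | inj₂ y≤x = trans (link-sym (rotated n k t) x y) (trans (link-ordered (rotated n k t) y≤x) (link-sym t _ _))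

Subsumed : ℕ → Template → Template → Set
Subsumed n t t′ = ∀ {y} → y < n → ∀ {x} → x < y → T (t x y) → T (t′ x y)

subsumed? : ∀ n t t′ → Dec (Subsumed n t t′)
subsumed? n t t′ = allUpTo? (λ y → allUpTo? (λ x → T? (t x y) →-dec T? (t′ x y)) y) n

module Positions {n : ℕ} {G : Graph n} (D : Drawing G) where
  open Drawing D public

  E : ℕ → ℕ → Set
  E x y = ∃[ u ] ∃[ v ] (pos u ≡ x × pos v ≡ y × Adj G u v)

  edge : ∀ {u v} → Adj G u v → E (pos u) (pos v)
  edge {u} {v} uv = u , v , refl , refl , uv

  E? : ∀ x y → Dec (E x y)
  E? x y = any? λ u → any? λ v → (pos u ≟ x) ×-dec (pos v ≟ y) ×-dec adj? G u v

  E-sym : ∀ {x y} → E x y → E y x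
  E-sym (u , v , refl , refl , uv) = v , u , refl , refl , trans (Graph.sym G v u) uv

  E-irrefl : ∀ {x} → ¬ E x x
  E-irrefl (u , v , refl , pv≡pu , uv) with pos-injective (sym pv≡pu)
  ... | refl = contradiction (trans (sym uv) (Graph.irrfl G u)) λ ()

  E<ˡ : ∀ {x y} → E x y → x < n
  E<ˡ (u , _ , refl , _ , _) = pos< u

  E<ʳ : ∀ {x y} → E x y → y < n
  E<ʳ (_ , v , _ , refl , _) = pos< v

  crossing : ∀ {a b c d} → E a b → E c d → a < c → c < b → b < d → ⊥
  crossing (_ , _ , refl , refl , ab) (_ , _ , refl , refl , cd) = nonCrossing ab cd

  Within : Template → Set
  Within t = ∀ {x y} → E x y → T (link t x y)

  link-intro : ∀ {t} → (∀ {x y} → x < y → E x y → T (t x y)) → Within t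
  link-intro {t} below {x} {y} xy with <-cmp x y
  ... | tri< x<y _ _ = subst T (sym (link-ordered t (<⇒≤ x<y))) (below x<y xy)
  ... | tri≈ _ refl _ = contradiction xy E-irrefl
  ... | tri> _ _ y<x =
    subst T (sym (trans (link-sym t x y) (link-ordered t (<⇒≤ y<x)))) (below y<x (E-sym xy))

  within : ∀ t → All (λ (x , y) → ¬ E x y) (omitted n t) → Within t
  within t absent = link-intro λ {x} {y} x<y xy → Dec.decidable-stable (T? (t x y)) λ ¬txy →
    All.lookup absent (∈-filter⁺ (λ (x , y) → x <? y ×-dec ¬? (T? (t x y)))
                        (∈-cartesianProduct⁺ (∈-upTo⁺ (E<ˡ xy)) (∈-upTo⁺ (E<ʳ xy))) (x<y , ¬txy))
                   xy

  Universal : ℕ → Set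
  Universal w = ∀ {x} → x < n → x ≢ w → E w x

  universal? : ∀ w → Dec (Universal w)
  universal? w = allUpTo? (λ x → ¬? (x ≟ w) →-dec E? w x) n

  Universal⇒IsUniversal : ∀ {w} → Universal (pos w) → IsUniversal G w
  Universal⇒IsUniversal {w} universal v v≢w
    with universal (pos< v) (v≢w ∘ pos-injective)
  ... | w′ , v′ , pw′≡pw , pv′≡pv , w′v′
    rewrite pos-injective pw′≡pw | pos-injective pv′≡pv = w′v′

  IsUniversal⇒Universal : ∀ {w} → IsUniversal G w → Universal (pos w)
  IsUniversal⇒Universal {w} adjacent {x} x<n x≢w with pos-onto x<n
  ... | v , refl = edge (adjacent v (x≢w ∘ cong pos))

  universal⇒fan : Universal 0 → Within fan
  universal⇒fan universal = link-intro {fan} λ x<y xy → Dec.fromWitness (spoke-or-rim x<y xy)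
    where
    spoke-or-rim : ∀ {x y} → x < y → E x y → x ≡ 0 ⊎ suc x ≡ y
    spoke-or-rim {zero} _ _ = inj₁ refl
    spoke-or-rim {suc x} {y} x<y xy with suc (suc x) ≟ y
    ... | yes 2+x≡y = inj₂ 2+x≡y
    ... | no 2+x≢y =
      ⊥-elim (crossing (universal (<-trans 2+x<y (E<ʳ xy)) λ ()) xy z<s (n<1+n (suc x)) 2+x<y)
      where 2+x<y = ≤∧≢⇒< x<y 2+x≢y

  Short : ℕ → ℕ → Set
  Short x y = ∣ x - y ∣ ≤ 2 ⊎ n ≤ ∣ x - y ∣ + 2

  short? : ∀ x y → Dec (Short x y)
  short? x y = (∣ x - y ∣ ≤? 2) ⊎-dec (n ≤? ∣ x - y ∣ + 2)

  module Diameter≤2 (diameter≤2 : ∀ u v → DistLe2 G u v) where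

    near : ∀ {x y} → x < n → y < n → x ≡ y ⊎ E x y ⊎ ∃[ z ] (E x z × E z y)
    near x<n y<n with pos-onto x<n | pos-onto y<n
    ... | u , refl | v , refl with diameter≤2 u v
    ... | inj₁ (inj₁ refl) = inj₁ refl
    ... | inj₁ (inj₂ uv)   = inj₂ (inj₁ (edge uv))
    ... | inj₂ (w , uw , wv) = inj₂ (inj₂ (pos w , edge uw , edge wv))

    non-neighbour : ∀ {w} → ¬ Universal w → ∃[ t ] (t < n × t ≢ w × ¬ E w t)
    non-neighbour {w} ¬universal with anyUpTo? (λ t → ¬? (¬? (t ≟ w) →-dec E? w t)) n
    ... | yes (t , t<n , missed) =
      t , t<n , (λ t≡w → missed λ t≢w → contradiction t≡w t≢w) , λ wt → missed λ _ → wt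
    ... | no none = contradiction
      (λ {t} t<n → Dec.decidable-stable (¬? (t ≟ w) →-dec E? w t) λ ¬p → none (t , t<n , ¬p)) ¬universal

    module _ {a b : ℕ} (ab : E a b) (a<b : a < b) where

      Inside Outside : ℕ → Set
      Inside x  = a < x × x < b
      Outside y = y < a ⊎ b < y

      locate : ∀ z → z ≡ a ⊎ z ≡ b ⊎ Inside z ⊎ Outside z
      locate z with <-cmp z a | <-cmp z b
      ... | tri≈ _ z≡a _ | _            = inj₁ z≡a
      ... | _            | tri≈ _ z≡b _ = inj₂ (inj₁ z≡b)
      ... | tri< z<a _ _ | _            = inj₂ (inj₂ (inj₂ (inj₁ z<a)))
      ... | _            | tri> _ _ b<z = inj₂ (inj₂ (inj₂ (inj₂ b<z)))
      ... | tri> _ _ a<z | tri< z<b _ _ = inj₂ (inj₂ (inj₁ (a<z , z<b)))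

      separated : ∀ {x y} → Inside x → Outside y → ¬ E x y
      separated (a<x , x<b) (inj₁ y<a) xy = crossing (E-sym xy) ab y<a a<x x<b
      separated (a<x , x<b) (inj₂ b<y) xy = crossing ab xy a<x x<b b<y

      throughEnds : ∀ {x y} → Inside x → Outside y → y < n → (E a x × E a y) ⊎ (E b x × E b y)
      throughEnds {x} {y} in-x out-y y<n with near (<-trans (proj₂ in-x) (E<ʳ ab)) y<n
      ... | inj₁ refl =
        contradiction out-y λ { (inj₁ x<a) → <-asym x<a (proj₁ in-x) ; (inj₂ b<x) → <-asym b<x (proj₂ in-x) }
      ... | inj₂ (inj₁ xy) = contradiction xy (separated in-x out-y)
      ... | inj₂ (inj₂ (z , xz , zy)) with locate z
      ...   | inj₁ refl = inj₁ (E-sym xz , zy)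
      ...   | inj₂ (inj₁ refl) = inj₂ (E-sym xz , zy)
      ...   | inj₂ (inj₂ (inj₁ in-z)) = contradiction zy (separated in-z out-y)
      ...   | inj₂ (inj₂ (inj₂ out-z)) = contradiction xz (separated in-x out-z)

      b-sees-outside : ∀ {t} → Inside t → ¬ E a t → ∀ {y} → y < n → Outside y → E b y
      b-sees-outside in-t ¬at y<n out-y with throughEnds in-t out-y y<n
      ... | inj₁ (at , _) = contradiction at ¬at
      ... | inj₂ (_ , by) = by

      a-sees-outside : ∀ {s} → Inside s → ¬ E b s → ∀ {y} → y < n → Outside y → E a y
      a-sees-outside in-s ¬bs y<n out-y with throughEnds in-s out-y y<n
      ... | inj₁ (_ , ay) = ay
      ... | inj₂ (bs , _) = contradiction bs ¬bs

      b-sees-inside : ∀ {t} → Outside t → ¬ E a t → t < n → ∀ {x} → Inside x → E b x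
      b-sees-inside out-t ¬at t<n in-x with throughEnds in-x out-t t<n
      ... | inj₁ (_ , at) = contradiction at ¬at
      ... | inj₂ (bx , _) = bx

      a-sees-inside : ∀ {s} → Outside s → ¬ E b s → s < n → ∀ {x} → Inside x → E a x
      a-sees-inside out-s ¬bs s<n in-x with throughEnds in-x out-s s<n
      ... | inj₁ (ax , _) = ax
      ... | inj₂ (_ , bs) = contradiction bs ¬bs

      ends-see-outside : ∀ {y₁ y₂} → y₁ < y₂ → y₂ < n → Outside y₁ → Outside y₂ →
                         (∀ {y} → y < n → Outside y → E a y) → (∀ {y} → y < n → Outside y → E b y) → ⊥
      ends-see-outside y₁<y₂ y₂<n out₁ out₂ sees-a sees-b with out₁ | out₂
      ... | inj₁ y₁<a | inj₁ y₂<a = crossing (E-sym (sees-a y₁<n out₁)) (E-sym (sees-b y₂<n out₂)) y₁<y₂ y₂<a a<b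
        where y₁<n = <-trans y₁<y₂ y₂<n
      ... | inj₁ y₁<a | inj₂ b<y₂ = crossing (E-sym (sees-b y₁<n out₁)) (sees-a y₂<n out₂) y₁<a a<b b<y₂
        where y₁<n = <-trans y₁<y₂ y₂<n
      ... | inj₂ b<y₁ | inj₁ y₂<a = <-asym (<-trans y₂<a a<b) (<-trans b<y₁ y₁<y₂)
      ... | inj₂ b<y₁ | inj₂ b<y₂ = crossing (sees-a y₁<n out₁) (sees-b y₂<n out₂) a<b b<y₁ y₁<y₂
        where y₁<n = <-trans y₁<y₂ y₂<n

      ends-see-inside : 3 + a ≤ b → (∀ {x} → Inside x → E a x) → (∀ {x} → Inside x → E b x) → ⊥
      ends-see-inside a+3≤b sees-a sees-b =
        crossing (sees-a (a<2+a , a+3≤b)) (E-sym (sees-b (a<1+a , <-trans (n<1+n (suc a)) a+3≤b)))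
                 a<1+a (n<1+n (suc a)) a+3≤b
        where
        a<1+a = n<1+n a
        a<2+a = <-trans a<1+a (n<1+n (suc a))

      -- The inside and the outside only meet through a or b: if a misses a position on one
      -- side, b sees the whole other side, and an end seeing a whole side forces a crossing.
      long-chord⇒universal : 3 + a ≤ b → ∀ {y₁ y₂} → y₁ < y₂ → y₂ < n → Outside y₁ → Outside y₂ →
                             Universal a ⊎ Universal b
      long-chord⇒universal a+3≤b y₁<y₂ y₂<n out₁ out₂ with universal? a | universal? b
      ... | yes universal-a | _ = inj₁ universal-a
      ... | no _ | yes universal-b = inj₂ universal-b
      ... | no ¬universal-a | no ¬universal-b
        with non-neighbour ¬universal-a | non-neighbour ¬universal-b
      ... | t , t<n , t≢a , ¬at | s , s<n , s≢b , ¬bs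
        with locate t | locate s
      ... | inj₁ t≡a | _ = contradiction t≡a t≢a
      ... | inj₂ (inj₁ refl) | _ = contradiction ab ¬at
      ... | _ | inj₁ refl = contradiction (E-sym ab) ¬bs
      ... | _ | inj₂ (inj₁ s≡b) = contradiction s≡b s≢b
      ... | inj₂ (inj₂ (inj₁ in-t)) | inj₂ (inj₂ (inj₂ out-s)) = ⊥-elim (¬bs (b-sees-outside in-t ¬at s<n out-s))
      ... | inj₂ (inj₂ (inj₂ out-t)) | inj₂ (inj₂ (inj₁ in-s)) = ⊥-elim (¬bs (b-sees-inside out-t ¬at t<n in-s))
      ... | inj₂ (inj₂ (inj₁ in-t)) | inj₂ (inj₂ (inj₁ in-s)) =
        ⊥-elim (ends-see-outside y₁<y₂ y₂<n out₁ out₂ (a-sees-outside in-s ¬bs) (b-sees-outside in-t ¬at))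
      ... | inj₂ (inj₂ (inj₂ out-t)) | inj₂ (inj₂ (inj₂ out-s)) =
        ⊥-elim (ends-see-inside a+3≤b (a-sees-inside out-s ¬bs s<n) (b-sees-inside out-t ¬at t<n))

    module NoUniversal (noUniversal : ∀ w → ¬ Universal w) where

      no-long-chord : ∀ {x y} → x < y → E x y → 3 + x ≤ y → (y ∸ x) + 2 < n → ⊥
      no-long-chord {x} {y} x<y xy far room = [ noUniversal x , noUniversal y ]′ (ends x<y xy far room)
        where
        ends : ∀ {x y} → x < y → E x y → 3 + x ≤ y → (y ∸ x) + 2 < n → Universal x ⊎ Universal y
        ends {0} {y} x<y xy far room =
          long-chord⇒universal xy x<y far (n<1+n (suc y)) (subst (_< n) (+-comm y 2) room)
                               (inj₂ (n<1+n y)) (inj₂ (<-trans (n<1+n y) (n<1+n (suc y))))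
        ends {1} {suc y} x<y xy far room =
          long-chord⇒universal xy x<y far z<s (subst (_< n) (+-comm y 2) room) (inj₁ z<s) (inj₂ (n<1+n (suc y)))
        ends {suc (suc x)} x<y xy far room =
          long-chord⇒universal xy x<y far z<s (≤-trans (s≤s (s≤s z≤n)) (<⇒≤ (E<ˡ xy))) (inj₁ z<s) (inj₁ (s≤s z<s))

      short-ordered : ∀ {x y} → x < y → E x y → Short x y
      short-ordered {x} {y} x<y xy = Dec.decidable-stable (short? x y) λ ¬short →
        no-long-chord x<y xy
          (subst (3 + x ≤_) (m∸n+n≡m (<⇒≤ x<y)) (+-monoˡ-≤ x (≰⇒> (¬short ∘ inj₁ ∘ subst (_≤ 2) (sym gap)))))
          (≰⇒> (¬short ∘ inj₂ ∘ subst (λ d → n ≤ d + 2) (sym gap)))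
        where
        gap : ∣ x - y ∣ ≡ y ∸ x
        gap = m≤n⇒∣m-n∣≡n∸m (<⇒≤ x<y)

      short : ∀ {x y} → E x y → True (short? x y)
      short {x} {y} xy = Dec.fromWitness (short′ (<-cmp x y))
        where
        short′ : Tri (x < y) (x ≡ y) (y < x) → Short x y
        short′ (tri< x<y _ _) = short-ordered x<y xy
        short′ (tri≈ _ refl _) = inj₁ (subst (_≤ 2) (sym (∣n-n∣≡0 x)) z≤n)
        short′ (tri> _ _ y<x) =
          subst (λ d → d ≤ 2 ⊎ n ≤ d + 2) (∣-∣-comm y x) (short-ordered y<x (E-sym xy))

      short-detour : ∀ x y → True (x <? n) → True (y <? n) → False (short? x y) →
                 Any (λ z → E x z × E z y) (filter (λ z → short? x z ×-dec short? z y) (upTo n))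
      short-detour x y x<n y<n far with near (toWitness x<n) (toWitness y<n)
      ... | inj₁ refl = contradiction (inj₁ (subst (_≤ 2) (sym (∣n-n∣≡0 x)) z≤n)) (toWitnessFalse far)
      ... | inj₂ (inj₁ xy) = contradiction (toWitness (short xy)) (toWitnessFalse far)
      ... | inj₂ (inj₂ (z , xz , zy)) =
        lose (∈-filter⁺ (λ z → short? x z ×-dec short? z y) (∈-upTo⁺ (E<ʳ xz))
                        (toWitness (short xz) , toWitness (short zy)))
             (xz , zy)

PathPattern : ∀ {A : Set} → A → A → A → A → A → Set
PathPattern x₀ x₁ x₂ x₃ x₄ =
  x₀ ≢ x₁ × x₀ ≢ x₂ × x₀ ≢ x₃ × x₁ ≢ x₂ × x₁ ≢ x₃ × x₂ ≢ x₃ × x₄ ≢ x₁ × x₄ ≢ x₂ × x₄ ≢ x₃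

map-PathPattern : ∀ {A B : Set} (f : A → B) → (∀ {a b} → f a ≡ f b → a ≡ b) →
                  ∀ {x₀ x₁ x₂ x₃ x₄} → PathPattern x₀ x₁ x₂ x₃ x₄ →
                  PathPattern (f x₀) (f x₁) (f x₂) (f x₃) (f x₄)
map-PathPattern f f-injective (d₀₁ , d₀₂ , d₀₃ , d₁₂ , d₁₃ , d₂₃ , d₄₁ , d₄₂ , d₄₃) =
  d₀₁ ∘ f-injective , d₀₂ ∘ f-injective , d₀₃ ∘ f-injective , d₁₂ ∘ f-injective , d₁₃ ∘ f-injective ,
  d₂₃ ∘ f-injective , d₄₁ ∘ f-injective , d₄₂ ∘ f-injective , d₄₃ ∘ f-injective

record IsStarColouring (E : ℕ → ℕ → Set) {K : ℕ} (c : ℕ → ℕ → Fin K) : Set where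
  field
    symmetric : ∀ {x y} → E x y → c x y ≡ c y x
    proper    : ∀ {x y z} → E x y → E x z → y ≢ z → c x y ≢ c x z
    star      : ∀ {x₀ x₁ x₂ x₃ x₄} → PathPattern x₀ x₁ x₂ x₃ x₄ →
                E x₀ x₁ → E x₁ x₂ → E x₂ x₃ → E x₃ x₄ →
                c x₀ x₁ ≡ c x₂ x₃ → c x₁ x₂ ≢ c x₃ x₄

restrict : ∀ {E F : ℕ → ℕ → Set} {K} {c : ℕ → ℕ → Fin K} →
           (∀ {x y} → E x y → F x y) → IsStarColouring F c → IsStarColouring E c
restrict E⊆F isStar = record
  { symmetric = symmetric ∘ E⊆F
  ; proper    = λ xy xz → proper (E⊆F xy) (E⊆F xz)
  ; star      = λ p e₁ e₂ e₃ e₄ → star p (E⊆F e₁) (E⊆F e₂) (E⊆F e₃) (E⊆F e₄)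
  }
  where open IsStarColouring isStar

alternate : ∀ {A : Set} {x y z a b : A} → (x ≡ a ⊎ x ≡ b) → (y ≡ a ⊎ y ≡ b) → (z ≡ a ⊎ z ≡ b) →
            x ≢ y → y ≢ z → x ≡ z
alternate (inj₁ refl) (inj₁ refl) _           x≢y _   = contradiction refl x≢y
alternate (inj₂ refl) (inj₂ refl) _           x≢y _   = contradiction refl x≢y
alternate (inj₁ refl) (inj₂ refl) (inj₁ refl) _   _   = refl
alternate (inj₁ refl) (inj₂ refl) (inj₂ refl) _   y≢z = contradiction refl y≢z
alternate (inj₂ refl) (inj₁ refl) (inj₁ refl) _   y≢z = contradiction refl y≢z
alternate (inj₂ refl) (inj₁ refl) (inj₂ refl) _   _   = refl

module _ {n : ℕ} {G : Graph n} (D : Drawing G) where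
  open Positions D

  transfer : ∀ {K} {c : ℕ → ℕ → Fin K} → IsStarColouring E c → StarColorable G K
  transfer {K} {c} isStar = colouring , proper′ , noTwoColoured
    where
    open IsStarColouring isStar
    colouring : EdgeColoring G K
    colouring = record { col = λ u v → c (pos u) (pos v) ; colSym = λ u v → symmetric ∘ edge }
    proper′ : Proper G colouring
    proper′ u v w uv uw v≢w = proper (edge uv) (edge uw) (v≢w ∘ pos-injective)
    noTwoColoured : ¬ TwoColoredP4orC4 G colouring
    noTwoColoured (v₀ , v₁ , v₂ , v₃ , v₄ , distinct , e₁ , e₂ , e₃ , e₄ , a , b , c₁ , c₂ , c₃ , c₄)
      with _ , d₀₂ , _ , _ , d₁₃ , _ , _ , d₄₂ , _ ← distinct =
      star (map-PathPattern pos pos-injective distinct) (edge e₁) (edge e₂) (edge e₃) (edge e₄)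
           (alternate c₁ c₂ c₃ (turn e₁ e₂ d₀₂) (turn e₂ e₃ d₁₃))
           (alternate c₂ c₃ c₄ (turn e₂ e₃ d₁₃) (turn e₃ e₄ (d₄₂ ∘ sym)))
      where
      turn : ∀ {x y z} → Adj G x y → Adj G y z → x ≢ z →
             c (pos x) (pos y) ≢ c (pos y) (pos z)
      turn {x} xy yz x≢z eq =
        proper (E-sym (edge xy)) (edge yz) (x≢z ∘ pos-injective) (trans (symmetric (E-sym (edge xy))) eq)

pathPattern? : ∀ x₀ x₁ x₂ x₃ x₄ → Dec (PathPattern x₀ x₁ x₂ x₃ x₄)
pathPattern? x₀ x₁ x₂ x₃ x₄ =
  x₀ ≢? x₁ ×-dec x₀ ≢? x₂ ×-dec x₀ ≢? x₃ ×-dec x₁ ≢? x₂ ×-dec x₁ ≢? x₃ ×-dec x₂ ≢? x₃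
    ×-dec x₄ ≢? x₁ ×-dec x₄ ≢? x₂ ×-dec x₄ ≢? x₃
  where
  _≢?_ : ∀ (x y : ℕ) → Dec (x ≢ y)
  x ≢? y = ¬? (x ≟ y)

-- a coloured graph on the positions, listing each edge {x , y} once, with x < y
Table : ℕ → Set
Table K = ℕ → ℕ → Maybe (Fin K)

module _ {K : ℕ} (table : Table (suc K)) where

  edges : Template
  edges x y = is-just (table x y)

  colour : ℕ → ℕ → Fin (suc K)
  colour x y = fromMaybe Fin.zero (table (x ⊓ y) (x ⊔ y))

  module _ (n : ℕ) where

    Edge : ℕ → ℕ → Set
    Edge x y = x < n × y < n × T (link edges x y)

    ProperOn : Set
    ProperOn = ∀ {x} → x < n → ∀ {y} → y < n → ∀ {z} → z < n →
               T (link edges x y) → T (link edges x z) → y ≢ z → colour x y ≢ colour x z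

    StarOn : Set
    StarOn = ∀ {x₀} → x₀ < n → ∀ {x₁} → x₁ < n → T (link edges x₀ x₁) →
             ∀ {x₂} → x₂ < n → T (link edges x₁ x₂) → ∀ {x₃} → x₃ < n → T (link edges x₂ x₃) →
             ∀ {x₄} → x₄ < n → T (link edges x₃ x₄) →
             PathPattern x₀ x₁ x₂ x₃ x₄ → colour x₀ x₁ ≡ colour x₂ x₃ → colour x₁ x₂ ≢ colour x₃ x₄

    private
      below : ∀ {P : ℕ → Set} → Decidable P → Dec (∀ {x} → x < n → P x)
      below P? = allUpTo? P? n

      edge? : ∀ x y → Dec (T (link edges x y))
      edge? x y = T? (link edges x y)

    properOn? : Dec ProperOn
    properOn? = below λ x → below λ y → below λ z →
      edge? x y →-dec edge? x z →-dec ¬? (y ≟ z) →-dec ¬? (colour x y Finₚ.≟ colour x z)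

    starOn? : Dec StarOn
    starOn? =
      below λ x₀ → below λ x₁ → edge? x₀ x₁ →-dec below λ x₂ → edge? x₁ x₂ →-dec
      below λ x₃ → edge? x₂ x₃ →-dec below λ x₄ → edge? x₃ x₄ →-dec
      pathPattern? x₀ x₁ x₂ x₃ x₄ →-dec (colour x₀ x₁ Finₚ.≟ colour x₂ x₃) →-dec
      ¬? (colour x₁ x₂ Finₚ.≟ colour x₃ x₄)

    table-star : True properOn? → True starOn? → IsStarColouring Edge colour
    table-star properOn starOn = record
      { symmetric = λ {x} {y} _ → cong₂ (λ a b → fromMaybe Fin.zero (table a b)) (⊓-comm x y) (⊔-comm x y)
      ; proper    = λ (x<n , y<n , xy) (_ , z<n , xz) → toWitness properOn x<n y<n z<n xy xz
      ; star      = λ p (x₀<n , x₁<n , e₁) (_ , x₂<n , e₂) (_ , x₃<n , e₃) (_ , x₄<n , e₄) →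
                      toWitness starOn x₀<n x₁<n e₁ x₂<n e₂ x₃<n e₃ x₄<n e₄ p
      }

module _ {n : ℕ} {G : Graph n} .{{_ : NonZero n}} (D : Drawing G) where
  open Positions D

  rotate-within : ∀ k t → Within (rotated n k t) → Positions.Within (rotateBy k D) t
  rotate-within k t within (u , v , refl , refl , uv)
    rewrite pos-rotateBy k D u | pos-rotateBy k D v =
    subst T (link-rotated n k t (pos u) (pos v)) (within (edge uv))

module _ {n : ℕ} {G : Graph n} (D : Drawing G) where
  open Positions D

  within-subsumed : ∀ {t t′} → True (subsumed? n t t′) → Within t → Within t′
  within-subsumed {t} sub within = link-intro λ x<y xy →
    toWitness sub (E<ʳ xy) x<y (subst T (link-ordered t (<⇒≤ x<y)) (within xy))

  table-colourable : ∀ {K} (table : Table (suc K)) → True (properOn? table n) → True (starOn? table n) →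
                  Within (edges table) → StarColorable G (suc K)
  table-colourable table proper star within =
    transfer D (restrict (λ xy → E<ˡ xy , E<ʳ xy , within xy) (table-star table n proper star))

module _ {K : ℕ} .{{_ : NonZero K}} where

  %-close-injective : ∀ {x y} → x % K ≡ y % K → x ≤ y → y < x + K → x ≡ y
  %-close-injective {x} {y} eq x≤y y<x+K with y / K ≤? x / K
  ... | yes q′≤q = ≤-antisym x≤y (begin
    y                    ≡⟨ m≡m%n+[m/n]*n y K ⟩
    y % K + y / K * K    ≤⟨ +-mono-≤ (≤-reflexive (sym eq)) (*-monoˡ-≤ K q′≤q) ⟩
    x % K + x / K * K    ≡⟨ m≡m%n+[m/n]*n x K ⟨
    x                    ∎)
    where open ≤-Reasoning
  ... | no q′≰q = contradiction y<x+K (≤⇒≯ (begin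
    x + K                     ≡⟨ cong (_+ K) (m≡m%n+[m/n]*n x K) ⟩
    x % K + x / K * K + K     ≡⟨ +-assoc (x % K) _ K ⟩
    x % K + (x / K * K + K)   ≡⟨ cong (x % K +_) (+-comm _ K) ⟩
    x % K + suc (x / K) * K   ≤⟨ +-mono-≤ (≤-reflexive eq) (*-monoˡ-≤ K (≰⇒> q′≰q)) ⟩
    y % K + y / K * K         ≡⟨ m≡m%n+[m/n]*n y K ⟨
    y                         ∎))
    where open ≤-Reasoning

  %-window-injective : ∀ {a x y} → x % K ≡ y % K → a ≤ x → x < a + K → a ≤ y → y < a + K → x ≡ y
  %-window-injective {a} {x} {y} eq a≤x x<a+K a≤y y<a+K with ≤-total x y
  ... | inj₁ x≤y = %-close-injective eq x≤y (<-≤-trans y<a+K (+-monoˡ-≤ K a≤x))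
  ... | inj₂ y≤x = sym (%-close-injective (sym eq) y≤x (<-≤-trans x<a+K (+-monoˡ-≤ K a≤y)))

  %-apart : ∀ x {d} → 0 < d → d < K → x % K ≢ (x + d) % K
  %-apart x 0<d d<K eq = <⇒≢ (m<m+n x 0<d) (%-close-injective eq (m≤m+n x _) (+-monoʳ-< x d<K))

  %-apart′ : ∀ {x y} d → 0 < d → d < K → y ≡ x + d → x % K ≢ y % K
  %-apart′ {x} d 0<d d<K refl = %-apart x 0<d d<K

  %-cong-+ : ∀ {x y} d → x % K ≡ y % K → (x + d) % K ≡ (y + d) % K
  %-cong-+ {x} {y} d eq = begin
    (x + d) % K               ≡⟨ %-distribˡ-+ x d K ⟩
    (x % K + d % K) % K       ≡⟨ cong (λ r → (r + d % K) % K) eq ⟩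
    (y % K + d % K) % K       ≡⟨ %-distribˡ-+ y d K ⟨
    (y + d) % K               ∎
    where open ≡-Reasoning

module FanColouring {K : ℕ} .{{_ : NonZero K}} (7≤K : 7 ≤ K) {n : ℕ} (n≤1+K : n ≤ suc K) where

  data Step (p : ℕ) : ℕ → ℕ → Set where
    up   : Step p p (suc p)
    down : Step p (suc p) p

  data FanView : ℕ → ℕ → Set where
    outward : ∀ {y} → suc y < n → FanView 0 (suc y)
    inward  : ∀ {x} → suc x < n → FanView (suc x) 0
    rim     : ∀ {p x y} → Step (suc p) x y → suc (suc p) < n → FanView x y

  FanEdge : ℕ → ℕ → Set
  FanEdge x y = x < n × y < n × x ≢ y × T (link fan x y)

  reverse : ∀ {x y} → FanView x y → FanView y x
  reverse (outward y<n)  = inward y<n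
  reverse (inward x<n)   = outward x<n
  reverse (rim up p<n)   = rim down p<n
  reverse (rim down p<n) = rim up p<n

  ascending : ∀ {x y} → x < y → y < n → x ≡ 0 ⊎ suc x ≡ y → FanView x y
  ascending {zero} {suc y} _ y<n _ = outward y<n
  ascending {suc x} _ y<n (inj₂ refl) = rim up y<n

  view : ∀ {x y} → FanEdge x y → FanView x y
  view (x<n , y<n , x≢y , xy) =
    [ (λ (x<y , fxy) → ascending x<y y<n (toWitness fxy))
    , (λ (y<x , fyx) → reverse (ascending y<x x<n (toWitness fyx))) ]′ (link-cases {fan} x≢y xy)

  -- the spoke to y has colour y and the rim edge {p , p + 1} has colour p + 3, modulo K
  shade : ℕ → ℕ → ℕ
  shade zero    y = y
  shade (suc x) _ = suc x + 3

  fanColour : ℕ → ℕ → Fin K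
  fanColour x y = shade (x ⊓ y) (x ⊔ y) mod K

  hue : ∀ {x y} → FanView x y → ℕ
  hue (outward {y} _) = suc y
  hue (inward {x} _)  = suc x
  hue (rim {p} _ _)   = suc p + 3

  fanColour-hue : ∀ {x y} (v : FanView x y) → toℕ (fanColour x y) ≡ hue v % K
  fanColour-hue (outward _) = toℕ-fromℕ< _
  fanColour-hue (inward _) = toℕ-fromℕ< _
  fanColour-hue (rim {p} up _) =
    trans (toℕ-fromℕ< _) (cong (λ q → (suc q + 3) % K) (m≤n⇒m⊓n≡m (n≤1+n p)))
  fanColour-hue (rim {p} down _) =
    trans (toℕ-fromℕ< _) (cong (λ q → (suc q + 3) % K) (m≥n⇒m⊓n≡n (n≤1+n p)))

  same-hue : ∀ {x y x′ y′} (v : FanView x y) (v′ : FanView x′ y′) →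
             fanColour x y ≡ fanColour x′ y′ → hue v % K ≡ hue v′ % K
  same-hue v v′ eq = trans (sym (fanColour-hue v)) (trans (cong toℕ eq) (fanColour-hue v′))

  spoke-injective : ∀ {y z} → suc y % K ≡ suc z % K → suc y < n → suc z < n → y ≡ z
  spoke-injective eq y<n z<n =
    suc-injective (%-window-injective eq (s≤s z≤n) (<-≤-trans y<n n≤1+K) (s≤s z≤n) (<-≤-trans z<n n≤1+K))

  rim-injective : ∀ {p q} → (p + 3) % K ≡ (q + 3) % K → suc p < n → suc q < n → p ≡ q
  rim-injective {p} {q} eq p<n q<n =
    +-cancelʳ-≡ 3 p q (%-window-injective eq (m≤n+m 3 p) (below p<n) (m≤n+m 3 q) (below q<n))
    where
    below : ∀ {r} → suc r < n → r + 3 < 3 + K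
    below {r} r<n = subst (_< 3 + K) (+-comm 3 r) (+-monoʳ-< 3 (s≤s⁻¹ (<-≤-trans r<n n≤1+K)))

  shared : ∀ {p a b c d} → Step p a b → Step p c d → c ≡ a ⊎ c ≡ b
  shared up   up   = inj₁ refl
  shared up   down = inj₂ refl
  shared down up   = inj₂ refl
  shared down down = inj₁ refl

  flip : ∀ {p a b} → Step p a b → Step p b a
  flip up   = down
  flip down = up

  Offset : ℕ → Set
  Offset δ = 2 ≤ δ × δ ≤ 3

  entry-offset : ∀ {p a b} → Step p a b → ∃[ δ ] (Offset δ × p + 3 ≡ b + δ)
  entry-offset {p} up = 2 , (≤-refl , n≤1+n 2) , +-suc p 2
  entry-offset down   = 3 , (n≤1+n 2 , ≤-refl) , refl

  exit-offset : ∀ {p a b} → Step p a b → ∃[ δ ] (Offset δ × p + 3 ≡ a + δ)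
  exit-offset s = entry-offset (flip s)

  own-rim : ∀ {q x z} → Step q x z → x % K ≢ (q + 3) % K
  own-rim s with exit-offset s
  ... | δ , (2≤δ , δ≤3) , eq = %-apart′ δ (<-≤-trans z<s 2≤δ) (≤-<-trans δ≤3 (<-≤-trans lt 7≤K)) eq

  far-rim : ∀ {p q a b c} → Step p a b → Step q b c → a ≢ c → a % K ≢ (q + 3) % K
  far-rim {p} up up _ = %-apart′ 4 z<s (<-≤-trans lt 7≤K) (sym (+-suc p 3))
  far-rim {q = q} down down _ = %-apart′ 1 z<s (<-≤-trans lt 7≤K) (trans (+-suc q 2) (cong suc (+-suc q 1)))
  far-rim up down a≢c = contradiction refl a≢c
  far-rim down up a≢c = contradiction refl a≢c

  -- a walk through the hub forces K ∣ δ + δ′ with 4 ≤ δ + δ′ ≤ 6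
  hub-between : ∀ {p q x₀ x₁ x₃ x₄} → Step p x₀ x₁ → Step q x₃ x₄ →
                (p + 3) % K ≡ x₃ % K → x₁ % K ≡ (q + 3) % K → ⊥
  hub-between {p} {q} {x₁ = x₁} {x₃ = x₃} s₁ s₄ eq₁₃ eq₂₄
    with entry-offset s₁ | exit-offset s₄
  ... | δ , (2≤δ , δ≤3) , e | δ′ , (2≤δ′ , δ′≤3) , e′ =
    %-apart x₁ (<-≤-trans z<s (+-mono-≤ 2≤δ 2≤δ′)) (≤-<-trans (+-mono-≤ δ≤3 δ′≤3) (<-≤-trans lt 7≤K))
      (begin
        x₁ % K                   ≡⟨ eq₂₄ ⟩
        (q + 3) % K              ≡⟨ cong (_% K) e′ ⟩
        (x₃ + δ′) % K            ≡⟨ %-cong-+ δ′ (trans (cong (_% K) (sym e)) eq₁₃) ⟨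
        (x₁ + δ + δ′) % K        ≡⟨ cong (_% K) (+-assoc x₁ δ δ′) ⟩
        (x₁ + (δ + δ′)) % K      ∎)
    where open ≡-Reasoning

  proper-by-hue : ∀ {x y z} (v : FanView x y) (w : FanView x z) → y ≢ z → hue v % K ≡ hue w % K → ⊥
  proper-by-hue (outward y<n) (outward z<n) y≢z eq = y≢z (cong suc (spoke-injective eq y<n z<n))
  proper-by-hue (inward _) (inward _) y≢z _ = y≢z refl
  proper-by-hue (inward _) (rim s _) _ eq = own-rim s eq
  proper-by-hue (rim s _) (inward _) _ eq = own-rim s (sym eq)
  proper-by-hue (rim {p} s p<n) (rim {q} s′ q<n) y≢z eq
    with rim-injective {suc p} {suc q} eq p<n q<n
  proper-by-hue (rim up   _) (rim up   _) y≢z _ | refl = y≢z refl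
  proper-by-hue (rim down _) (rim down _) y≢z _ | refl = y≢z refl

  same-rim : ∀ {p q a b c d} → Step p a b → Step q c d → p ≡ q → c ≡ a ⊎ c ≡ b
  same-rim s s′ refl = shared s s′

  star-by-hue : ∀ {x₀ x₁ x₂ x₃ x₄} → PathPattern x₀ x₁ x₂ x₃ x₄ →
          (e₁ : FanView x₀ x₁) (e₂ : FanView x₁ x₂) (e₃ : FanView x₂ x₃) (e₄ : FanView x₃ x₄) →
          hue e₁ % K ≡ hue e₃ % K → hue e₂ % K ≢ hue e₄ % K
  star-by-hue (_ , _ , _ , _ , _ , _ , _ , d₄₂ , _) (inward _) (outward _) (rim s₃ _) (rim s₄ _) _ =
    far-rim s₃ s₄ (d₄₂ ∘ sym)
  star-by-hue (_ , _ , _ , _ , d₁₃ , _) (inward _) (outward _) (inward _) _ _ = λ _ → d₁₃ refl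
  star-by-hue (_ , _ , _ , _ , _ , _ , d₄₁ , _) (inward _) (outward _) (rim _ _) (inward _) _ = λ _ → d₄₁ refl
  star-by-hue _ (rim s₁ _) (inward _) (outward _) (rim s₄ _) eq₁₃ = hub-between s₁ s₄ eq₁₃
  star-by-hue (_ , d₀₂ , _) (outward _) (inward _) _ _ _ = λ _ → d₀₂ refl
  star-by-hue (_ , _ , _ , _ , _ , _ , _ , d₄₂ , _) _ (inward _) (outward _) (inward _) _ = λ _ → d₄₂ refl
  star-by-hue (_ , d₀₂ , _) (rim s₁ _) (rim s₂ _) (inward _) _ eq₁₃ =
    λ _ → far-rim (flip s₂) (flip s₁) (d₀₂ ∘ sym) (sym eq₁₃)
  star-by-hue (_ , _ , d₀₃ , _) (outward _) (rim _ _) (inward _) _ _ = λ _ → d₀₃ refl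
  star-by-hue (_ , _ , _ , _ , d₁₃ , _) (outward _) (rim s₂ _) (rim s₃ _) (inward _) eq₁₃ =
    λ _ → far-rim s₂ s₃ d₁₃ eq₁₃
  star-by-hue (_ , _ , _ , _ , d₁₃ , d₂₃ , _) (outward _) (rim {p} s₂ p<n) (rim _ _) (rim {q} s₄ q<n) _ eq₂₄ =
    [ d₁₃ ∘ sym , d₂₃ ∘ sym ]′ (same-rim s₂ s₄ (rim-injective {suc p} {suc q} eq₂₄ p<n q<n))
  star-by-hue (_ , d₀₂ , _ , d₁₂ , _) (rim {p} s₁ p<n) (rim _ _) (rim {q} s₃ q<n) _ eq₁₃ _ =
    [ d₀₂ ∘ sym , d₁₂ ∘ sym ]′ (same-rim s₁ s₃ (rim-injective {suc p} {suc q} eq₁₃ p<n q<n))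

  fan-star : IsStarColouring FanEdge fanColour
  fan-star = record
    { symmetric = λ {x} {y} _ → cong₂ (λ a b → shade a b mod K) (⊓-comm x y) (⊔-comm x y)
    ; proper    = λ xy xz y≢z eq → proper-by-hue (view xy) (view xz) y≢z (same-hue (view xy) (view xz) eq)
    ; star      = λ p e₁ e₂ e₃ e₄ eq₁₃ eq₂₄ →
                    star-by-hue p (view e₁) (view e₂) (view e₃) (view e₄)
                          (same-hue (view e₁) (view e₃) eq₁₃) (same-hue (view e₂) (view e₄) eq₂₄)
    }

module _ {n : ℕ} {G : Graph n} .{{_ : NonZero n}} (D : Drawing G) where
  open Positions D

  hub-vertex : ∃[ w ] (w < n × Universal w) → ∃ (IsUniversal G)
  hub-vertex (w , w<n , universal) with pos-onto w<n
  ... | v , refl = v , Universal⇒IsUniversal universal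

  centred : ∃ (IsUniversal G) → Σ (Drawing G) λ D′ → Positions.Within D′ fan
  centred (v , adjacent) = centre D v , Positions.universal⇒fan (centre D v)
    (subst (Positions.Universal (centre D v)) (pos-centre D v) (Positions.IsUniversal⇒Universal (centre D v) adjacent))

  fan-colourable : ∀ {K} .{{_ : NonZero K}} → 7 ≤ K → n ≤ suc K → ∃ (IsUniversal G) → StarColorable G K
  fan-colourable 7≤K n≤1+K universal = transfer D′ (restrict fan-edge (FanColouring.fan-star 7≤K n≤1+K))
    where
    D′ = proj₁ (centred universal)
    open Positions D′ using () renaming (E to E′; E<ˡ to E′<ˡ; E<ʳ to E′<ʳ; E-irrefl to E′-irrefl)
    fan-edge : ∀ {x y} → E′ x y → FanColouring.FanEdge 7≤K n≤1+K x y
    fan-edge xy = E′<ˡ xy , E′<ʳ xy , (λ { refl → E′-irrefl xy }) , proj₂ (centred universal) xy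

any₃ : ∀ {A : Set} {P : A → Set} {a b c} → Any P (a ∷ b ∷ c ∷ []) → P a ⊎ P b ⊎ P c
any₃ (here p)                 = inj₁ p
any₃ (there (here p))         = inj₂ (inj₁ p)
any₃ (there (there (here p))) = inj₂ (inj₂ p)

any₄ : ∀ {A : Set} {P : A → Set} {a b c d} → Any P (a ∷ b ∷ c ∷ d ∷ []) → P a ⊎ P b ⊎ P c ⊎ P d
any₄ (here p)   = inj₁ p
any₄ (there ps) = inj₂ (any₃ ps)

module _ {n : ℕ} {G : Graph n} (D : Drawing G) where
  open Positions D

  find-universal : 0 < n → (∃[ w ] (w < n × Universal w)) ⊎ (∀ w → ¬ Universal w)
  find-universal 0<n with anyUpTo? universal? n
  ... | yes found = inj₁ found
  ... | no none = inj₂ λ w universal → none (w , bounded universal , universal)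
    where
    bounded : ∀ {w} → Universal w → w < n
    bounded {zero} _ = 0<n
    bounded {suc w} universal = E<ˡ (universal 0<n λ ())

-- Without a universal vertex, 0 and 4 can only be joined through the chords {0 , 2} and {2 , 4},
-- or {0 , 6} and {6 , 4} when n = 8, and likewise 1 and 5 through {1 , 3} and {3 , 5}, or
-- {1 , 7} and {7 , 5}; each choice of the two detours contains two crossing chords.
module _ {t : ℕ} {G : Graph (8 + t)} (D : Drawing G) (diameter≤2 : ∀ u v → DistLe2 G u v) where
  open Positions D
  open Diameter≤2 diameter≤2

  private
    far-back : ∀ {a z} → 3 ≤ a → a ≤ 5 → z < t → ¬ (a + z ≤ 2 ⊎ 8 + t ≤ a + z + 2)
    far-back 3≤a _ _ (inj₁ a+z≤2) = contradiction (≤-trans 3≤a (≤-trans (m≤m+n _ _) a+z≤2)) λ { (s≤s (s≤s ())) }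
    far-back {a} {z} _ a≤5 z<t (inj₂ n≤a+z+2) = <⇒≱ (+-monoʳ-≤ 8 (<⇒≤ z<t)) (begin
      8 + t          ≤⟨ n≤a+z+2 ⟩
      a + z + 2      ≤⟨ +-monoˡ-≤ 2 (+-monoˡ-≤ z a≤5) ⟩
      5 + z + 2      ≡⟨ cong (5 +_) (+-comm z 2) ⟩
      7 + z          ∎)
      where open ≤-Reasoning

    short-only-if-8 : 6 ≤ 2 ⊎ 8 + t ≤ 6 + 2 → t ≡ 0
    short-only-if-8 (inj₁ (s≤s (s≤s ())))
    short-only-if-8 (inj₂ 8+t≤8) = n≤0⇒n≡0 (+-cancelˡ-≤ 8 t 0 8+t≤8)

  private module ShortChordsOnly (noUniversal : ∀ w → ¬ Universal w) where
    open NoUniversal noUniversal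

    detour₀₄ : (E 0 2 × E 2 4) ⊎ (t ≡ 0 × E 0 6 × E 6 4)
    detour₀₄ with near {0} lt lt
    ... | inj₂ (inj₁ e) = ⊥-elim (short e)
    ... | inj₂ (inj₂ (0 , e , _)) = ⊥-elim (E-irrefl e)
    ... | inj₂ (inj₂ (1 , _ , e)) = ⊥-elim (short e)
    ... | inj₂ (inj₂ (2 , e₁ , e₂)) = inj₁ (e₁ , e₂)
    ... | inj₂ (inj₂ (3 , e , _)) = ⊥-elim (short e)
    ... | inj₂ (inj₂ (4 , _ , e)) = ⊥-elim (E-irrefl e)
    ... | inj₂ (inj₂ (5 , e , _)) = ⊥-elim (short e)
    ... | inj₂ (inj₂ (6 , e₁ , e₂)) = inj₂ (short-only-if-8 (toWitness (short e₁)) , e₁ , e₂)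
    ... | inj₂ (inj₂ (7 , _ , e)) = ⊥-elim (short e)
    ... | inj₂ (inj₂ (suc (suc (suc (suc (suc (suc (suc (suc z))))))) , _ , e)) =
      ⊥-elim (far-back lt lt (+-cancelˡ-< 8 z t (E<ˡ e)) (toWitness (short e)))

    detour₁₅ : (E 1 3 × E 3 5) ⊎ (t ≡ 0 × E 1 7 × E 7 5)
    detour₁₅ with near {1} lt lt
    ... | inj₂ (inj₁ e) = ⊥-elim (short e)
    ... | inj₂ (inj₂ (0 , _ , e)) = ⊥-elim (short e)
    ... | inj₂ (inj₂ (1 , e , _)) = ⊥-elim (E-irrefl e)
    ... | inj₂ (inj₂ (2 , _ , e)) = ⊥-elim (short e)
    ... | inj₂ (inj₂ (3 , e₁ , e₂)) = inj₁ (e₁ , e₂)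
    ... | inj₂ (inj₂ (4 , e , _)) = ⊥-elim (short e)
    ... | inj₂ (inj₂ (5 , _ , e)) = ⊥-elim (E-irrefl e)
    ... | inj₂ (inj₂ (6 , e , _)) = ⊥-elim (short e)
    ... | inj₂ (inj₂ (7 , e₁ , e₂)) = inj₂ (short-only-if-8 (toWitness (short e₁)) , e₁ , e₂)
    ... | inj₂ (inj₂ (suc (suc (suc (suc (suc (suc (suc (suc z))))))) , _ , e)) =
      ⊥-elim (far-back lt lt (+-cancelˡ-< 8 z t (E<ˡ e)) (toWitness (short e)))

    impossible : ⊥
    impossible = cross detour₀₄ detour₁₅
      where
      cross : (E 0 2 × E 2 4) ⊎ (t ≡ 0 × E 0 6 × E 6 4) → (E 1 3 × E 3 5) ⊎ (t ≡ 0 × E 1 7 × E 7 5) → ⊥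
      cross (inj₁ (e₀₂ , _))     (inj₁ (e₁₃ , _))     = crossing e₀₂ e₁₃ lt lt lt
      cross (inj₁ (e₀₂ , _))     (inj₂ (_ , e₁₇ , _)) = crossing e₀₂ e₁₇ lt lt lt
      cross (inj₂ (_ , _ , e₆₄)) (inj₁ (_ , e₃₅))     = crossing e₃₅ (E-sym e₆₄) lt lt lt
      cross (inj₂ (_ , e₀₆ , _)) (inj₂ (_ , e₁₇ , _)) = crossing e₀₆ e₁₇ lt lt lt

  universal≥8 : ∃[ w ] (w < 8 + t × Universal w)
  universal≥8 = [ id , ⊥-elim ∘ ShortChordsOnly.impossible ]′ (find-universal D z<s)

  colourable≥8 : StarColorable G (7 + t) × 7 + t ≤ maxDeg G
  colourable≥8 =
    let v , universal = hub-vertex D universal≥8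
    in fan-colourable D (m≤m+n 7 t) ≤-refl (v , universal) , ≤-trans (universal-deg G universal refl) (deg≤maxDeg G v)

module _ {G : Graph 7} (D : Drawing G) (diameter≤2 : ∀ u v → DistLe2 G u v) where
  open Positions D
  open Diameter≤2 diameter≤2

  -- Without a universal vertex every chord is some cᵢ = {i - 1 , i + 1}; cᵢ and cᵢ₊₁ cross, and
  -- each pair of positions three apart is joined through one of three patterns of such chords.
  private module ShortChordsOnly (noUniversal : ∀ w → ¬ Universal w) where
    open NoUniversal noUniversal

    detour₀₃ : E 1 3 ⊎ E 0 2 ⊎ (E 0 5 × E 5 3)
    detour₀₃ = Sum.map proj₂ (Sum.map₁ proj₁) (any₃ (short-detour 0 3 _ _ _))

    detour₁₄ : E 2 4 ⊎ E 1 3 ⊎ (E 1 6 × E 6 4)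
    detour₁₄ = Sum.map proj₂ (Sum.map₁ proj₁) (any₃ (short-detour 1 4 _ _ _))

    detour₂₅ : (E 2 0 × E 0 5) ⊎ E 3 5 ⊎ E 2 4
    detour₂₅ = Sum.map₂ (Sum.map proj₂ proj₁) (any₃ (short-detour 2 5 _ _ _))

    detour₃₆ : (E 3 1 × E 1 6) ⊎ E 4 6 ⊎ E 3 5
    detour₃₆ = Sum.map₂ (Sum.map proj₂ proj₁) (any₃ (short-detour 3 6 _ _ _))

    detour₄₀ : (E 4 2 × E 2 0) ⊎ E 5 0 ⊎ E 4 6
    detour₄₀ = Sum.map₂ (Sum.map proj₂ proj₁) (any₃ (short-detour 4 0 _ _ _))

    detour₅₁ : E 5 0 ⊎ (E 5 3 × E 3 1) ⊎ E 6 1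
    detour₅₁ = Sum.map proj₁ (Sum.map₂ proj₂) (any₃ (short-detour 5 1 _ _ _))

    detour₆₂ : E 0 2 ⊎ E 6 1 ⊎ (E 6 4 × E 4 2)
    detour₆₂ = Sum.map proj₂ (Sum.map₁ proj₁) (any₃ (short-detour 6 2 _ _ _))

    impossible : ⊥
    impossible = split (E? 0 2)
      where
      split : Dec (E 0 2) → ⊥
      split (yes c₁) = [ ¬c₆ ∘ E-sym , [ ¬c₄ ∘ E-sym ∘ proj₁ , ¬c₀ ∘ E-sym ]′ ]′ detour₅₁
        where
        ¬c₀ : ¬ E 1 6
        ¬c₀ c₀ = crossing c₁ c₀ lt lt lt
        ¬c₂ : ¬ E 1 3
        ¬c₂ c₂ = crossing c₁ c₂ lt lt lt
        c₃ : E 2 4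
        c₃ = [ id , [ ⊥-elim ∘ ¬c₂ , ⊥-elim ∘ ¬c₀ ∘ proj₁ ]′ ]′ detour₁₄
        ¬c₄ : ¬ E 3 5
        ¬c₄ c₄ = crossing c₃ c₄ lt lt lt
        c₅ : E 4 6
        c₅ = [ ⊥-elim ∘ ¬c₀ ∘ proj₂ , [ id , ⊥-elim ∘ ¬c₄ ]′ ]′ detour₃₆
        ¬c₆ : ¬ E 0 5
        ¬c₆ c₆ = crossing c₆ c₅ lt lt lt
      split (no ¬c₁) = [ throughC₂ , [ ¬c₁ , throughC₆C₄ ]′ ]′ detour₀₃
        where
        throughC₂ : E 1 3 → ⊥
        throughC₂ c₂ = [ ¬c₃ ∘ E-sym ∘ proj₁ , [ ¬c₆ ∘ E-sym , ¬c₅ ]′ ]′ detour₄₀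
          where
          ¬c₃ : ¬ E 2 4
          ¬c₃ c₃ = crossing c₂ c₃ lt lt lt
          c₀ : E 1 6
          c₀ = E-sym ([ ⊥-elim ∘ ¬c₁ , [ id , ⊥-elim ∘ ¬c₃ ∘ E-sym ∘ proj₂ ]′ ]′ detour₆₂)
          ¬c₆ : ¬ E 0 5
          ¬c₆ c₆ = crossing c₆ c₀ lt lt lt
          c₄ : E 3 5
          c₄ = [ ⊥-elim ∘ ¬c₁ ∘ E-sym ∘ proj₁ , [ id , ⊥-elim ∘ ¬c₃ ]′ ]′ detour₂₅
          ¬c₅ : ¬ E 4 6
          ¬c₅ c₅ = crossing c₄ c₅ lt lt lt
        throughC₆C₄ : E 0 5 × E 5 3 → ⊥
        throughC₆C₄ (c₆ , c₄′) = [ ¬c₁ , [ ¬c₀ ∘ E-sym , ¬c₅ ∘ E-sym ∘ proj₁ ]′ ]′ detour₆₂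
          where
          ¬c₅ : ¬ E 4 6
          ¬c₅ c₅ = crossing (E-sym c₄′) c₅ lt lt lt
          ¬c₀ : ¬ E 1 6
          ¬c₀ c₀ = crossing c₆ c₀ lt lt lt

  universal₇ : ∃[ w ] (w < 7 × Universal w)
  universal₇ = [ id , ⊥-elim ∘ ShortChordsOnly.impossible ]′ (find-universal D z<s)

  colourable₇ : StarColorable G 7
  colourable₇ = fan-colourable D lt lt (hub-vertex D universal₇)

-- star colourings of the small extremal graphs, found by computer search
k₃ : Table 3
k₃ 0 1 = just (# 0)
k₃ 0 2 = just (# 1)
k₃ 1 2 = just (# 2)
k₃ _ _ = nothing

k₄ : Table 4
k₄ 0 1 = just (# 0)
k₄ 0 2 = just (# 1)
k₄ 0 3 = just (# 2)
k₄ 1 2 = just (# 2)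
k₄ 2 3 = just (# 3)
k₄ _ _ = nothing

fan₅ : Table 6
fan₅ 0 1 = just (# 0)
fan₅ 0 2 = just (# 1)
fan₅ 0 3 = just (# 2)
fan₅ 0 4 = just (# 3)
fan₅ 1 2 = just (# 2)
fan₅ 2 3 = just (# 4)
fan₅ 3 4 = just (# 5)
fan₅ _ _ = nothing

fan₆ : Table 6
fan₆ 0 1 = just (# 0)
fan₆ 0 2 = just (# 1)
fan₆ 0 3 = just (# 2)
fan₆ 0 4 = just (# 3)
fan₆ 0 5 = just (# 4)
fan₆ 1 2 = just (# 4)
fan₆ 2 3 = just (# 5)
fan₆ 3 4 = just (# 0)
fan₆ 4 5 = just (# 5)
fan₆ _ _ = nothing

sun : Table 6
sun 0 1 = just (# 0)
sun 1 2 = just (# 1)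
sun 2 3 = just (# 0)
sun 3 4 = just (# 2)
sun 4 5 = just (# 1)
sun 0 5 = just (# 2)
sun 0 2 = just (# 3)
sun 2 4 = just (# 4)
sun 0 4 = just (# 5)
sun _ _ = nothing

module _ {G : Graph 6} (D : Drawing G) (diameter≤2 : ∀ u v → DistLe2 G u v) where
  open Positions D
  open Diameter≤2 diameter≤2

  -- Without a universal vertex every chord is some cᵢ = {i - 1 , i + 1}; two such chords with
  -- indices of different parity must be opposite, and then a pair three apart has no short path.
  private module ShortChordsOnly (noUniversal : ∀ w → ¬ Universal w) where
    open NoUniversal noUniversal

    detour₀₃ : E 1 3 ⊎ E 0 2 ⊎ E 0 4 ⊎ E 3 5
    detour₀₃ = Sum.map proj₂ (Sum.map proj₁ (Sum.map proj₁ (E-sym ∘ proj₂))) (any₄ (short-detour 0 3 _ _ _))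

    detour₁₄ : E 0 4 ⊎ E 2 4 ⊎ E 1 3 ⊎ E 1 5
    detour₁₄ = Sum.map proj₂ (Sum.map proj₂ (Sum.map proj₁ proj₁)) (any₄ (short-detour 1 4 _ _ _))

    detour₂₅ : E 0 2 ⊎ E 1 5 ⊎ E 3 5 ⊎ E 2 4
    detour₂₅ = Sum.map (E-sym ∘ proj₁) (Sum.map proj₂ (Sum.map proj₂ proj₁)) (any₄ (short-detour 2 5 _ _ _))

    parity : Dec (E 1 5) → Dec (E 1 3) → Dec (E 3 5) →
           (¬ E 1 5 × ¬ E 1 3 × ¬ E 3 5) ⊎ (¬ E 0 2 × ¬ E 2 4 × ¬ E 0 4)
    parity (yes c₀) _ _ = inj₂ (¬c₁ , ¬c₃ , ¬c₅)
      where
      ¬c₁ : ¬ E 0 2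
      ¬c₁ c₁ = crossing c₁ c₀ lt lt lt
      ¬c₅ : ¬ E 0 4
      ¬c₅ c₅ = crossing c₅ c₀ lt lt lt
      ¬c₃ : ¬ E 2 4
      ¬c₃ c₃ =
        [ (λ c₂ → crossing c₂ c₃ lt lt lt) , [ ¬c₁ , [ ¬c₅ , (λ c₄ → crossing c₃ c₄ lt lt lt) ]′ ]′ ]′ detour₀₃
    parity _ (yes c₂) _ = inj₂ (¬c₁ , ¬c₃ , ¬c₅)
      where
      ¬c₁ : ¬ E 0 2
      ¬c₁ c₁ = crossing c₁ c₂ lt lt lt
      ¬c₃ : ¬ E 2 4
      ¬c₃ c₃ = crossing c₂ c₃ lt lt lt
      ¬c₅ : ¬ E 0 4
      ¬c₅ c₅ =
        [ ¬c₁ , [ (λ c₀ → crossing c₅ c₀ lt lt lt) , [ (λ c₄ → crossing c₅ c₄ lt lt lt) , ¬c₃ ]′ ]′ ]′ detour₂₅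
    parity _ _ (yes c₄) = inj₂ (¬c₁ , ¬c₃ , ¬c₅)
      where
      ¬c₃ : ¬ E 2 4
      ¬c₃ c₃ = crossing c₃ c₄ lt lt lt
      ¬c₅ : ¬ E 0 4
      ¬c₅ c₅ = crossing c₅ c₄ lt lt lt
      ¬c₁ : ¬ E 0 2
      ¬c₁ c₁ =
        [ ¬c₅ , [ ¬c₃ , [ (λ c₂ → crossing c₁ c₂ lt lt lt) , (λ c₀ → crossing c₁ c₀ lt lt lt) ]′ ]′ ]′ detour₁₄
    parity (no ¬c₀) (no ¬c₂) (no ¬c₄) = inj₁ (¬c₀ , ¬c₂ , ¬c₄)

    in-sun : Within (edges sun) ⊎ Within (rotated 6 1 (edges sun))
    in-sun = Sum.map
      (λ (¬c₀ , ¬c₂ , ¬c₄) → within (edges sun) (short ∷ ¬c₂ ∷ short ∷ ¬c₀ ∷ short ∷ ¬c₄ ∷ []))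
      (λ (¬c₁ , ¬c₃ , ¬c₅) → within (rotated 6 1 (edges sun)) (¬c₁ ∷ short ∷ ¬c₅ ∷ short ∷ ¬c₃ ∷ short ∷ []))
      (parity (E? 1 5) (E? 1 3) (E? 3 5))

  hexagon : ∃[ w ] (w < 6 × Universal w) ⊎ Within (edges sun) ⊎ Within (rotated 6 1 (edges sun))
  hexagon = Sum.map₂ ShortChordsOnly.in-sun (find-universal D z<s)

  hexagon-colourable : StarColorable G 6
  hexagon-colourable =
    [ fan-case
    , [ table-colourable D sun _ _ , table-colourable (rotateBy 1 D) sun _ _ ∘ rotate-within D 1 (edges sun) ]′
    ]′ hexagon
    where
    fan-case : ∃[ w ] (w < 6 × Universal w) → StarColorable G 6
    fan-case universal =
      let D′ , within = centred D (hub-vertex D universal)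
      in table-colourable D′ fan₆ _ _ (within-subsumed D′ {fan} {edges fan₆} _ within)

module _ {G : Graph 5} (D : Drawing G) where
  open Positions D

  hubAt : ℕ → Template
  hubAt p = rotated 5 (5 ∸ p) (edges fan₅)

  -- two chords cᵢ = {i - 1 , i + 1} of a pentagon that do not cross share an end p, so the graph
  -- lies in the fan at p
  pentagon : ∃[ p ] (p < 5 × Within (hubAt p))
  pentagon = fanAt (E? 1 4) (E? 0 2) (E? 1 3) (E? 2 4)
    where
    fanAt : Dec (E 1 4) → Dec (E 0 2) → Dec (E 1 3) → Dec (E 2 4) → ∃[ p ] (p < 5 × Within (hubAt p))
    fanAt (yes c₀) _ (yes c₂) _ = 1 , lt , within (hubAt 1) (¬c₁ ∷ ¬c₄ ∷ ¬c₃ ∷ [])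
      where
      ¬c₁ = λ c₁ → crossing c₁ c₀ lt lt lt
      ¬c₄ = λ c₄ → crossing c₄ c₀ lt lt lt
      ¬c₃ = λ c₃ → crossing c₂ c₃ lt lt lt
    fanAt (yes c₀) _ (no ¬c₂) (yes c₃) = 4 , lt , within (hubAt 4) (¬c₁ ∷ ¬c₄ ∷ ¬c₂ ∷ [])
      where
      ¬c₁ = λ c₁ → crossing c₁ c₀ lt lt lt
      ¬c₄ = λ c₄ → crossing c₄ c₀ lt lt lt
    fanAt (yes c₀) _ (no _) (no ¬c₃) = 1 , lt , within (hubAt 1) (¬c₁ ∷ ¬c₄ ∷ ¬c₃ ∷ [])
      where
      ¬c₁ = λ c₁ → crossing c₁ c₀ lt lt lt
      ¬c₄ = λ c₄ → crossing c₄ c₀ lt lt lt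
    fanAt (no ¬c₀) (yes c₁) _ (yes c₃) = 2 , lt , within (hubAt 2) (¬c₄ ∷ ¬c₂ ∷ ¬c₀ ∷ [])
      where
      ¬c₄ = λ c₄ → crossing c₄ c₃ lt lt lt
      ¬c₂ = λ c₂ → crossing c₁ c₂ lt lt lt
    fanAt (no ¬c₀) (yes c₁) _ (no ¬c₃) = 0 , lt , within (hubAt 0) (¬c₂ ∷ ¬c₀ ∷ ¬c₃ ∷ [])
      where
      ¬c₂ = λ c₂ → crossing c₁ c₂ lt lt lt
    fanAt (no ¬c₀) (no ¬c₁) (yes c₂) _ = 3 , lt , within (hubAt 3) (¬c₁ ∷ ¬c₀ ∷ ¬c₃ ∷ [])
      where
      ¬c₃ = λ c₃ → crossing c₂ c₃ lt lt lt
    fanAt (no ¬c₀) (no ¬c₁) (no ¬c₂) (yes c₃) = 4 , lt , within (hubAt 4) (¬c₁ ∷ ¬c₄ ∷ ¬c₂ ∷ [])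
      where
      ¬c₄ = λ c₄ → crossing c₄ c₃ lt lt lt
    fanAt (no ¬c₀) (no ¬c₁) (no ¬c₂) (no ¬c₃) = 0 , lt , within (hubAt 0) (¬c₂ ∷ ¬c₀ ∷ ¬c₃ ∷ [])

  pentagon-colourable : StarColorable G 6
  pentagon-colourable =
    let p , _ , within = pentagon
    in table-colourable (rotateBy (5 ∸ p) D) fan₅ _ _ (rotate-within D (5 ∸ p) (edges fan₅) within)

module _ {G : Graph 4} (D : Drawing G) where
  open Positions D

  -- the two diagonals of a quadrilateral cross
  quadrilateral : Within (edges k₄) ⊎ Within (rotated 4 1 (edges k₄))
  quadrilateral = diagonal (E? 0 2)
    where
    diagonal : Dec (E 0 2) → Within (edges k₄) ⊎ Within (rotated 4 1 (edges k₄))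
    diagonal (yes e₀₂) = inj₁ (within (edges k₄) ((λ e₁₃ → crossing e₀₂ e₁₃ lt lt lt) ∷ []))
    diagonal (no ¬e₀₂) = inj₂ (within (rotated 4 1 (edges k₄)) (¬e₀₂ ∷ []))

  quadrilateral-colourable : StarColorable G 4
  quadrilateral-colourable =
    [ table-colourable D k₄ _ _ , table-colourable (rotateBy 1 D) k₄ _ _ ∘ rotate-within D 1 (edges k₄) ]′ quadrilateral

module _ {G : Graph 3} (D : Drawing G) where
  open Positions D

  triangle-colourable : StarColorable G 3
  triangle-colourable = table-colourable D k₃ _ _ (within (edges k₃) [])

-- the bound of the theorem; for n ≤ 3 it asks for none, and n serves
paperBound : (n : ℕ) → Graph n → ℕ
paperBound 5 _ = 6
paperBound (suc (suc (suc (suc (suc (suc (suc (suc _)))))))) G = maxDeg G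
paperBound n _ = n

bound-conditions : ∀ {n} {G : Graph n} {k} → 3 ≤ n → k ≤ paperBound n G →
                   (n ≡ 5 → k ≤ n + 1) × ((n ≡ 4 ⊎ n ≡ 6 ⊎ n ≡ 7) → k ≤ n) × (8 ≤ n → k ≤ maxDeg G)
bound-conditions {1} (s≤s ())
bound-conditions {2} (s≤s (s≤s ()))
bound-conditions {3} _ k≤3 = (λ ()) , (λ { (inj₁ ()) ; (inj₂ (inj₁ ())) ; (inj₂ (inj₂ ())) }) , ⊥-elim ∘ <⇒≱ lt
bound-conditions {4} _ k≤4 = (λ ()) , (λ _ → k≤4) , ⊥-elim ∘ <⇒≱ lt
bound-conditions {5} _ k≤6 = (λ _ → k≤6) , (λ { (inj₁ ()) ; (inj₂ (inj₁ ())) ; (inj₂ (inj₂ ())) }) , ⊥-elim ∘ <⇒≱ lt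
bound-conditions {6} _ k≤6 = (λ ()) , (λ _ → k≤6) , ⊥-elim ∘ <⇒≱ lt
bound-conditions {7} _ k≤7 = (λ ()) , (λ _ → k≤7) , ⊥-elim ∘ <⇒≱ lt
bound-conditions {suc (suc (suc (suc (suc (suc (suc (suc _)))))))} _ k≤Δ =
  (λ ()) , (λ { (inj₁ ()) ; (inj₂ (inj₁ ())) ; (inj₂ (inj₂ ())) }) , λ _ → k≤Δ

upper-bound : ∀ {n} (G : Graph n) → 3 ≤ n → Drawing G → (∀ u v → DistLe2 G u v) →
              ∃[ K ] (StarColorable G K × K ≤ paperBound n G)
upper-bound {1} G (s≤s ()) D _
upper-bound {2} G (s≤s (s≤s ())) D _
upper-bound {3} G _ D _ = 3 , triangle-colourable D , ≤-refl
upper-bound {4} G _ D _ = 4 , quadrilateral-colourable D , ≤-refl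
upper-bound {5} G _ D _ = 6 , pentagon-colourable D , ≤-refl
upper-bound {6} G _ D diameter≤2 = 6 , hexagon-colourable D diameter≤2 , ≤-refl
upper-bound {7} G _ D diameter≤2 = 7 , colourable₇ D diameter≤2 , ≤-refl
upper-bound {suc (suc (suc (suc (suc (suc (suc (suc t)))))))} G _ D diameter≤2 = 7 + t , colourable≥8 D diameter≤2

theorem2p6 : (n : ℕ) → 1 ≤ n → (G : Graph n) →
    TwoConnected G → Outerplanar G → Diameter2 G →
    ∃[ k ] ( IsStarChromaticIndex G k
           × maxDeg G ≤ k
           × (n ≡ 5 → k ≤ n + 1)
           × ((n ≡ 4 ⊎ n ≡ 6 ⊎ n ≡ 7) → k ≤ n)
           × (8 ≤ n → k ≤ maxDeg G) )
theorem2p6 n _ G (3≤n , _) outerplanar (_ , diameter≤2 , _) =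
  let K , colourableK , K≤bound = upper-bound G 3≤n (outerplanar⇒drawing G outerplanar) diameter≤2
      k , colourable , minimal = least (starColorable? G) colourableK
      c , proper , _ = colourable
  in k , (colourable , minimal) , maxDeg≤ G (deg≤colours G c proper) ,
     bound-conditions 3≤n (≤-trans (minimal K colourableK) K≤bound)
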